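{- Let $\Sigma=\{0,1,2,3\}$, let $S,S'\subset\Sigma^n$ be double-codes, and let $i,i'\in\{1,\ldots,n\}$. Then: (a) $S\cap\backslash_iS=\emptyset$; (b) $\backslash_i\backslash_iS=S$; (c) $|S|=|\backslash_iS|$; (d) $S\subseteq S'$ if and only if $\backslash_iS\subseteq\backslash_iS'$; (e) if $S\cup S'$ is a double-code, then $\backslash_i(S\cup S')=\backslash_iS\cup\backslash_iS'$; (f) $S$ is a double-MDS-code if and only if $\backslash_iS$ is a double-MDS-code; and $S$ is a double-MDS-code if and only if $\backslash_iS=\Sigma^n\setminus S$; (g) $S$ is complementable if and only if $\backslash_iS$ is a complementable double-code; (h) $S$ is prime if and only if $\backslash_iS$ is a prime double-code; (i) if $S$ is prime, then either $\backslash_iS=\backslash_{i'}S$ or $\backslash_iS\cap\backslash_{i'}S=\emptyset$; (j) if $S$ is complementable, then $\backslash_i\backslash_{i'}S=\backslash_{i'}\backslash_iS$; (k) $S$ is a double-MDS-code if and only if $|S|>0$ and $\backslash_jS=\backslash_{j'}S$ for all $j,j'\in\{1,\ldots,n\}$.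
   Context: A line ($i$-line) of $\Sigma^n$ is a set of four words that differ only in the $i$th coordinate. $\mathcal E_i(\bar x)$ denotes the $i$-line containing $\bar x$. For $T\subseteq\Sigma^n$, $\mathcal E_i(T)=\bigcup_{\bar x\in T}\mathcal E_i(\bar x)$ and $\backslash_iT=\mathcal E_i(T)\setminus T$. A double-code meets every line in $0$ or $2$ elements; a double-MDS-code meets every line in exactly $2$ elements. A double-code is complementable if it is a subset of some double-MDS-code. It is prime if it is complementable, nonempty, and cannot be split into more than one nonempty double-codes. -}

module Defs where

open import Data.Nat using (ℕ; zero; suc; _+_; _≥_; _>_)
open import Data.Fin using (Fin)
open import Data.Bool using (Bool; true; false; _∧_; _∨_; not; if_then_else_)
open import Data.Vec using (Vec; []; _∷_; _[_]≔_)
open import Data.List using (List; []; _∷_; [_]; map; concatMap; length; allFin)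
open import Data.Nat.ListAction using (sum)
open import Data.Bool.ListAction using (any)
open import Data.List.Relation.Unary.All using (All)
open import Data.List.Relation.Unary.Any using (Any)
open import Data.List.Relation.Unary.AllPairs using (AllPairs)
open import Data.Product using (Σ; ∃; _×_)
open import Data.Sum using (_⊎_)
open import Relation.Nullary using (¬_)
open import Relation.Binary.PropositionalEquality using (_≡_)
open import Function.Bundles using (_⇔_)

Alphabet : Set
Alphabet = Fin 4

Word : ℕ → Set
Word n = Vec Alphabet n

Subset : ℕ → Set
Subset n = Word n → Bool

allWords : (n : ℕ) → List (Word n)
allWords zero = [ [] ]
allWords (suc n) = concatMap (λ a → map (a ∷_) (allWords n)) (allFin 4)

∣_∣ : ∀ {n} → Subset n → ℕ
∣_∣ {n} S = sum (map (λ x → if S x then 1 else 0) (allWords n))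

module _ {n : ℕ} where

  _∈_ : Word n → Subset n → Set
  x ∈ S = S x ≡ true

  _⊆_ : Subset n → Subset n → Set
  S ⊆ T = ∀ x → x ∈ S → x ∈ T

  _≐_ : Subset n → Subset n → Set
  S ≐ T = ∀ x → S x ≡ T x

  _∩_ : Subset n → Subset n → Subset n
  (S ∩ T) x = S x ∧ T x

  _∪_ : Subset n → Subset n → Subset n
  (S ∪ T) x = S x ∨ T x

  ∁ : Subset n → Subset n
  ∁ S x = not (S x)

  ∅ : Subset n
  ∅ x = false

  Nonempty : Subset n → Set
  Nonempty S = ∃ λ x → x ∈ S

  -- |S ∩ E_i(x)| : number of elements of S on the i-line through x
  lineCount : Subset n → Fin n → Word n → ℕ
  lineCount S i x = sum (map (λ a → if S (x [ i ]≔ a) then 1 else 0) (allFin 4))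

  E : Fin n → Subset n → Subset n
  E i T x = any (λ a → T (x [ i ]≔ a)) (allFin 4)

  ∖[_]_ : Fin n → Subset n → Subset n
  (∖[ i ] T) x = E i T x ∧ not (T x)

  DoubleCode : Subset n → Set
  DoubleCode S = ∀ (i : Fin n) (x : Word n) → lineCount S i x ≡ 0 ⊎ lineCount S i x ≡ 2

  DoubleMDS : Subset n → Set
  DoubleMDS S = ∀ (i : Fin n) (x : Word n) → lineCount S i x ≡ 2

  Complementable : Subset n → Set
  Complementable S = ∃ λ M → DoubleMDS M × S ⊆ M

  Splitting : Subset n → Set
  Splitting S = ∃ λ (parts : List (Subset n)) →
      length parts ≥ 2
    × All Nonempty parts
    × All DoubleCode parts
    × AllPairs (λ P Q → (P ∩ Q) ≐ ∅) parts
    × (∀ x → x ∈ S ⇔ Any (λ P → x ∈ P) parts)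

  Prime : Subset n → Set
  Prime S = Complementable S × Nonempty S × ¬ Splitting S

-- On a single line, ∖ᵢ turns a pair of points into the complementary pair and keeps the
-- empty line empty; (a), (b), (d), (e) and the first half of (f) are pointwise
-- consequences of such facts about the 16 subsets of a line, which are checked
-- exhaustively, and (c) and the second half of (f) follow by double counting along lines.  For S inside a double-MDS-code
-- M, the trace of S on the plane of directions i and j through a word is a union of rows
-- of the trace of M, a 4×4 grid with two points on every row and column; an exhaustive
-- check over these grids shows that ∖ᵢ S is a double-code along j, that ∖ᵢ and ∖ⱼ commute
-- on S, and that ∖ᵢ S and ∖ⱼ S coincide or are disjoint when S ⊆ ∖ᵢ ∖ⱼ S or S is disjoint
-- from it.  For prime S these are the only cases, as S ∩ ∖ᵢ ∖ⱼ S and S ∖ ∖ᵢ ∖ⱼ S would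
-- otherwise split S.  (g) and (h) follow by transporting complements and splittings
-- through ∖ᵢ and back with (b).  For (k), if all ∖ⱼ S agree then S ∪ ∖ᵢ S = Eⱼ(S) for
-- every j, so it is closed under changing any coordinate and hence all of Σⁿ.
module Submission where

open import Defs
open import Algebra.Properties.CommutativeSemigroup using (interchange)
open import Data.Bool using (Bool; true; false; _∧_; _∨_; not; if_then_else_)
open import Data.Bool.ListAction using (any; all)
open import Data.Bool.Properties
  using (∧-conicalˡ; ∧-conicalʳ; ∧-zeroʳ; ∧-identityʳ; ∨-inverseʳ; not-involutive; not-injective; T-≡; ¬-not)
open import Data.Fin using (Fin; zero; suc; _≟_)
open import Data.List using (List; []; _∷_; _++_; map; concatMap; allFin)
open import Data.List.Membership.Propositional using (lose; find) renaming (_∈_ to _∈ₗ_)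
open import Data.List.Membership.Propositional.Properties using (∈-allFin; ∈-map⁺; ∈-concatMap⁺)
open import Data.List.Properties using (map-cong; map-++; map-∘; length-map)
open import Data.List.Relation.Unary.All using (All; []; _∷_)
import Data.List.Relation.Unary.All as All
open import Data.List.Relation.Unary.All.Properties using (all⁺; all⁻) renaming (map⁺ to All-map⁺)
open import Data.List.Relation.Unary.AllPairs using (AllPairs; []; _∷_)
open import Data.List.Relation.Unary.Any using (Any; here; there; satisfied)
import Data.List.Relation.Unary.Any as Any
open import Data.List.Relation.Unary.Any.Properties using (any⁺; any⁻) renaming (map⁺ to Any-map⁺; map⁻ to Any-map⁻)
open import Data.Nat using (ℕ; zero; suc; _+_; _*_; _≡ᵇ_; _≤_; _<_; _>_; z≤n; s≤s)
open import Data.Nat.ListAction using (sum)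
open import Data.Nat.ListAction.Properties using (sum-++)
open import Data.Nat.Properties
  using (≡ᵇ⇒≡; ≤-trans; ≤-reflexive; ≤-antisym; *-zeroʳ; *-distribˡ-+; *-cancelˡ-≡; +-cancelˡ-≡; +-cancelʳ-≤;
         +-mono-≤; +-monoʳ-≤; n≮0; +-commutativeSemigroup)
open import Data.Product using (∃; _,_; _×_; proj₁; proj₂)
open import Data.Sum using (_⊎_; inj₁; inj₂)
open import Data.Vec using (Vec; []; _∷_; lookup; tabulate; replicate; _[_]≔_)
open import Data.Vec.Properties using (tabulate-cong; lookup∘tabulate; []≔-idempotent; []≔-lookup; []≔-commutes)
open import Function using (_∘_)
open import Function.Bundles using (Equivalence; _⇔_; mk⇔)
open import Relation.Binary.PropositionalEquality
  using (_≡_; _≢_; refl; sym; trans; cong; cong₂; subst; _≗_; module ≡-Reasoning)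
open import Relation.Nullary using (yes; no; contradiction)
open ≡-Reasoning

private variable A B : Set

infixr 4 _⇒_
_⇒_ : Bool → Bool → Bool
true  ⇒ c = c
false ⇒ c = true

⇒-elim : ∀ {b c} → (b ⇒ c) ≡ true → b ≡ true → c ≡ true
⇒-elim h refl = h

⇒-intro : ∀ {b c} → (b ≡ true → c ≡ true) → (b ⇒ c) ≡ true
⇒-intro {true}  h = h refl
⇒-intro {false} h = refl

_==_ : Bool → Bool → Bool
true  == c = c
false == c = not c

==-sound : ∀ {b c} → (b == c) ≡ true → b ≡ c
==-sound {true}          h = sym h
==-sound {false} {false} _ = refl

not-sound : ∀ {b} → not b ≡ true → b ≡ false
not-sound = not-injective

∧-intro : ∀ {b c} → b ≡ true → c ≡ true → (b ∧ c) ≡ true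
∧-intro refl c = c

∧-true-false : ∀ {b c} → b ≡ true → (b ∧ c) ≡ false → c ≡ false
∧-true-false refl b∧c≡false = b∧c≡false

∨-∧-not : ∀ b c → (b ≡ true → c ≡ true) → (b ∨ (c ∧ not b)) ≡ c
∨-∧-not true  c b⇒c = sym (b⇒c refl)
∨-∧-not false c _   = ∧-identityʳ c

∀ᵛ : ∀ k → (Vec Bool k → Bool) → Bool
∀ᵛ zero    p = p []
∀ᵛ (suc k) p = ∀ᵛ k (p ∘ (false ∷_)) ∧ ∀ᵛ k (p ∘ (true ∷_))

∀ᵛ-sound : ∀ k p → ∀ᵛ k p ≡ true → ∀ v → p v ≡ true
∀ᵛ-sound zero    p h []          = h
∀ᵛ-sound (suc k) p h (false ∷ v) = ∀ᵛ-sound k _ (∧-conicalˡ _ _ h) v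
∀ᵛ-sound (suc k) p h (true  ∷ v) = ∀ᵛ-sound k _ (∧-conicalʳ _ _ h) v

∀ᶠ : (Fin 4 → Bool) → Bool
∀ᶠ p = all p (allFin 4)

∀ᶠ-sound : ∀ p → ∀ᶠ p ≡ true → ∀ a → p a ≡ true
∀ᶠ-sound p h a = Equivalence.to T-≡ (All.lookup (all⁺ p (allFin 4) (Equivalence.from T-≡ h)) (∈-allFin a))

∀ᶠ-complete : ∀ p → (∀ a → p a ≡ true) → ∀ᶠ p ≡ true
∀ᶠ-complete p h = Equivalence.to T-≡ (all⁻ p {allFin 4} (All.tabulate (λ {a} _ → Equivalence.from T-≡ (h a))))

Line : Set
Line = Fin 4 → Bool

-- A P : Line → _ that evaluates its argument only at the four literals of Fin 4
-- (as everything checked exhaustively below does) gives definitionally equal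
-- results on canon f and f, which is how the checks apply to arbitrary lines.
canon : Line → Line
canon f = lookup (tabulate f)

canon-cong : (P : Line → A) {f g : Line} → f ≗ g → P (canon f) ≡ P (canon g)
canon-cong P f≗g = cong (P ∘ lookup) (tabulate-cong f≗g)

∀ˡ : (Line → Bool) → Bool
∀ˡ p = ∀ᵛ 4 (p ∘ lookup)

∀ˡ-sound : ∀ p → ∀ˡ p ≡ true → ∀ f → p (canon f) ≡ true
∀ˡ-sound p h f = ∀ᵛ-sound 4 (p ∘ lookup) h (tabulate f)

∀ˡ²-sound : ∀ (p : Line → Line → Bool) → ∀ˡ (λ f → ∀ˡ (p f)) ≡ true →
            ∀ f g → p (canon f) (canon g) ≡ true
∀ˡ²-sound p h f = ∀ˡ-sound (p (canon f)) (∀ˡ-sound (λ f → ∀ˡ (p f)) h f)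

∀ˡ³-sound : ∀ (p : Line → Line → Line → Bool) → ∀ˡ (λ f → ∀ˡ λ g → ∀ˡ (p f g)) ≡ true →
            ∀ f g h → p (canon f) (canon g) (canon h) ≡ true
∀ˡ³-sound p h f g = ∀ˡ-sound (p (canon f) (canon g)) (∀ˡ²-sound (λ f g → ∀ˡ (p f g)) h f g)

count : Line → ℕ
count f = sum (map (λ a → if f a then 1 else 0) (allFin 4))

some : Line → Bool
some f = any f (allFin 4)

count-cong : ∀ {f g} → f ≗ g → count f ≡ count g
count-cong = canon-cong count

some-cong : ∀ {f g} → f ≗ g → some f ≡ some g
some-cong = canon-cong some

some-sound : ∀ f → some f ≡ true → ∃ λ a → f a ≡ true
some-sound f h with satisfied (any⁻ f (allFin 4) (Equivalence.from T-≡ h))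
... | a , fa = a , Equivalence.to T-≡ fa

some-complete : ∀ f a → f a ≡ true → some f ≡ true
some-complete f a fa = Equivalence.to T-≡ (any⁺ f (lose (∈-allFin a) (Equivalence.from T-≡ fa)))

∖ˡ : Line → Line
∖ˡ f a = some f ∧ not (f a)

∖ˡ-cong : ∀ {f g} → f ≗ g → ∖ˡ f ≗ ∖ˡ g
∖ˡ-cong f≗g a = cong₂ _∧_ (some-cong f≗g) (cong not (f≗g a))

Double : Line → Set
Double f = count f ≡ 0 ⊎ count f ≡ 2

Pair : Line → Set
Pair f = count f ≡ 2

double-resp : ∀ {f g} → f ≗ g → Double f → Double g
double-resp f≗g = subst (λ c → c ≡ 0 ⊎ c ≡ 2) (count-cong f≗g)

pair-resp : ∀ {f g} → f ≗ g → Pair f → Pair g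
pair-resp f≗g p = trans (sym (count-cong f≗g)) p

double≤2 : ∀ f → Double f → count f ≤ 2
double≤2 f (inj₁ c≡0) = ≤-trans (≤-reflexive c≡0) z≤n
double≤2 f (inj₂ c≡2) = ≤-reflexive c≡2

isDouble : ℕ → Bool
isDouble 0 = true
isDouble 2 = true
isDouble _ = false

isTwo : ℕ → Bool
isTwo 2 = true
isTwo _ = false

double? pair? : Line → Bool
double? f = isDouble (count f)
pair?   f = isTwo (count f)

double?-complete : ∀ f → Double f → double? f ≡ true
double?-complete f (inj₁ c≡0) = cong isDouble c≡0
double?-complete f (inj₂ c≡2) = cong isDouble c≡2

double?-sound : ∀ f → double? f ≡ true → Double f
double?-sound f = go (count f)
  where
  go : ∀ m → isDouble m ≡ true → m ≡ 0 ⊎ m ≡ 2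
  go 0 _ = inj₁ refl
  go 2 _ = inj₂ refl

pair?-complete : ∀ f → Pair f → pair? f ≡ true
pair?-complete f c≡2 = cong isTwo c≡2

pair?-sound : ∀ f → pair? f ≡ true → Pair f
pair?-sound f = go (count f)
  where
  go : ∀ m → isTwo m ≡ true → m ≡ 2
  go 2 _ = refl

_⊆ˡ_ : Line → Line → Set
f ⊆ˡ g = ∀ a → f a ≡ true → g a ≡ true

_⊆ᵇ_ _≈ᵇ_ disjoint? : Line → Line → Bool
f ⊆ᵇ g       = ∀ᶠ λ a → f a ⇒ g a
f ≈ᵇ g       = ∀ᶠ λ a → f a == g a
disjoint? f g = ∀ᶠ λ a → not (f a ∧ g a)

⊆ᵇ-complete : ∀ f g → f ⊆ˡ g → (f ⊆ᵇ g) ≡ true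
⊆ᵇ-complete f g f⊆g = ∀ᶠ-complete (λ a → f a ⇒ g a) (λ a → ⇒-intro (f⊆g a))

⊆ᵇ-sound : ∀ f g → (f ⊆ᵇ g) ≡ true → f ⊆ˡ g
⊆ᵇ-sound f g h a = ⇒-elim (∀ᶠ-sound (λ a → f a ⇒ g a) h a)

≈ᵇ-sound : ∀ f g → (f ≈ᵇ g) ≡ true → f ≗ g
≈ᵇ-sound f g h a = ==-sound (∀ᶠ-sound (λ a → f a == g a) h a)

disjoint?-complete : ∀ f g → (∀ a → (f a ∧ g a) ≡ false) → disjoint? f g ≡ true
disjoint?-complete f g h = ∀ᶠ-complete (λ a → not (f a ∧ g a)) (λ a → cong not (h a))

disjoint?-sound : ∀ f g → disjoint? f g ≡ true → ∀ a → (f a ∧ g a) ≡ false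
disjoint?-sound f g h a = not-sound (∀ᶠ-sound (λ a → not (f a ∧ g a)) h a)

∀ˡ⇒-sound : ∀ (h c : Line → Bool) → ∀ˡ (λ f → h f ⇒ c f) ≡ true →
            ∀ f → h (canon f) ≡ true → c (canon f) ≡ true
∀ˡ⇒-sound h c ok f = ⇒-elim (∀ˡ-sound (λ f → h f ⇒ c f) ok f)

∀ˡ²⇒-sound : ∀ (h c : Line → Line → Bool) → ∀ˡ (λ f → ∀ˡ λ g → h f g ⇒ c f g) ≡ true →
             ∀ f g → h (canon f) (canon g) ≡ true → c (canon f) (canon g) ≡ true
∀ˡ²⇒-sound h c ok f g = ⇒-elim (∀ˡ²-sound (λ f g → h f g ⇒ c f g) ok f g)

∀ˡ³⇒-sound : ∀ (h c : Line → Line → Line → Bool) →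
             ∀ˡ (λ f → ∀ˡ λ g → ∀ˡ λ k → h f g k ⇒ c f g k) ≡ true →
             ∀ f g k → h (canon f) (canon g) (canon k) ≡ true → c (canon f) (canon g) (canon k) ≡ true
∀ˡ³⇒-sound h c ok f g k = ⇒-elim (∀ˡ³-sound (λ f g k → h f g k ⇒ c f g k) ok f g k)

∖ˡ-involutive : ∀ f → Double f → ∖ˡ (∖ˡ f) ≗ f
∖ˡ-involutive f d = ≈ᵇ-sound (∖ˡ (∖ˡ f)) f
  (∀ˡ⇒-sound double? (λ f → ∖ˡ (∖ˡ f) ≈ᵇ f) refl f (double?-complete f d))

count-∖ˡ : ∀ f → Double f → count (∖ˡ f) ≡ count f
count-∖ˡ f d = ≡ᵇ⇒≡ (count (∖ˡ f)) (count f) (Equivalence.from T-≡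
  (∀ˡ⇒-sound double? (λ f → count (∖ˡ f) ≡ᵇ count f) refl f (double?-complete f d)))

∖ˡ-double : ∀ f → Double f → Double (∖ˡ f)
∖ˡ-double f d rewrite count-∖ˡ f d = d

∖ˡ-mono : ∀ f g → Double f → Double g → f ⊆ˡ g → ∖ˡ f ⊆ˡ ∖ˡ g
∖ˡ-mono f g df dg f⊆g = ⊆ᵇ-sound (∖ˡ f) (∖ˡ g)
  (∀ˡ²⇒-sound (λ f g → double? f ∧ double? g ∧ f ⊆ᵇ g) (λ f g → ∖ˡ f ⊆ᵇ ∖ˡ g) refl f g
    (∧-intro (double?-complete f df) (∧-intro (double?-complete g dg) (⊆ᵇ-complete f g f⊆g))))

_∪ˡ_ : Line → Line → Line
(f ∪ˡ g) a = f a ∨ g a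

∖ˡ-∪ : ∀ f g → Double f → Double g → Double (f ∪ˡ g) → ∖ˡ (f ∪ˡ g) ≗ (∖ˡ f ∪ˡ ∖ˡ g)
∖ˡ-∪ f g df dg dfg = ≈ᵇ-sound (∖ˡ (f ∪ˡ g)) (∖ˡ f ∪ˡ ∖ˡ g)
  (∀ˡ²⇒-sound (λ f g → double? f ∧ double? g ∧ double? (f ∪ˡ g)) (λ f g → ∖ˡ (f ∪ˡ g) ≈ᵇ (∖ˡ f ∪ˡ ∖ˡ g)) refl f g
    (∧-intro (double?-complete f df) (∧-intro (double?-complete g dg) (double?-complete (f ∪ˡ g) dfg))))

∖ˡ-pair : ∀ f → Pair f → ∖ˡ f ≗ not ∘ f
∖ˡ-pair f p = ≈ᵇ-sound (∖ˡ f) (not ∘ f)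
  (∀ˡ⇒-sound pair? (λ f → ∖ˡ f ≈ᵇ (not ∘ f)) refl f (pair?-complete f p))

pair-not : ∀ f → Pair f → Pair (not ∘ f)
pair-not f p = pair?-sound (not ∘ f) (∀ˡ⇒-sound pair? (λ f → pair? (not ∘ f)) refl f (pair?-complete f p))

pair-some : ∀ f → Pair f → some f ≡ true
pair-some f p = ∀ˡ⇒-sound pair? some refl f (pair?-complete f p)

double-some⇒pair : ∀ f → Double f → some f ≡ true → Pair f
double-some⇒pair f d s = pair?-sound f
  (∀ˡ⇒-sound (λ f → double? f ∧ some f) pair? refl f (∧-intro (double?-complete f d) s))

∖ˡ-some : ∀ f → Double f → some f ≡ true → some (∖ˡ f) ≡ true
∖ˡ-some f d s = trans (some-cong (∖ˡ-pair f p)) (pair-some (not ∘ f) (pair-not f p))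
  where
  p : Pair f
  p = double-some⇒pair f d s

⊆pair-shape : ∀ f m → Double f → Pair m → f ⊆ˡ m → f ≗ (λ a → some f ∧ m a)
⊆pair-shape f m df pm f⊆m = ≈ᵇ-sound f (λ a → some f ∧ m a)
  (∀ˡ²⇒-sound (λ f m → double? f ∧ pair? m ∧ f ⊆ᵇ m) (λ f m → f ≈ᵇ (λ a → some f ∧ m a)) refl f m
    (∧-intro (double?-complete f df) (∧-intro (pair?-complete m pm) (⊆ᵇ-complete f m f⊆m))))

∖ˡ-⊆-not : ∀ f m → Double f → Pair m → f ⊆ˡ m → ∖ˡ f ⊆ˡ (not ∘ m)
∖ˡ-⊆-not f m df pm f⊆m = ⊆ᵇ-sound (∖ˡ f) (not ∘ m)
  (∀ˡ²⇒-sound (λ f m → double? f ∧ pair? m ∧ f ⊆ᵇ m) (λ f m → ∖ˡ f ⊆ᵇ (not ∘ m)) refl f m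
    (∧-intro (double?-complete f df) (∧-intro (pair?-complete m pm) (⊆ᵇ-complete f m f⊆m))))

∖ˡ-disjoint : ∀ f g t → Double f → Double g → Double t → f ⊆ˡ t → g ⊆ˡ t →
              (∀ a → (f a ∧ g a) ≡ false) → ∀ a → (∖ˡ f a ∧ ∖ˡ g a) ≡ false
∖ˡ-disjoint f g t df dg dt f⊆t g⊆t f∩g = disjoint?-sound (∖ˡ f) (∖ˡ g)
  (∀ˡ³⇒-sound (λ f g t → double? f ∧ double? g ∧ double? t ∧ f ⊆ᵇ t ∧ g ⊆ᵇ t ∧ disjoint? f g)
              (λ f g _ → disjoint? (∖ˡ f) (∖ˡ g)) refl f g t
    (∧-intro (double?-complete f df) (∧-intro (double?-complete g dg) (∧-intro (double?-complete t dt)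
      (∧-intro (⊆ᵇ-complete f t f⊆t) (∧-intro (⊆ᵇ-complete g t g⊆t) (disjoint?-complete f g f∩g)))))))

∩-double : ∀ f g m → Double f → Double g → Pair m → f ⊆ˡ m → g ⊆ˡ m →
           Double (λ a → f a ∧ g a) × Double (λ a → f a ∧ not (g a))
∩-double f g m df dg pm f⊆m g⊆m =
  double?-sound (λ a → f a ∧ g a) (∧-conicalˡ _ _ both) , double?-sound (λ a → f a ∧ not (g a)) (∧-conicalʳ _ _ both)
  where
  both : (double? (λ a → f a ∧ g a) ∧ double? (λ a → f a ∧ not (g a))) ≡ true
  both = ∀ˡ³⇒-sound (λ f g m → double? f ∧ double? g ∧ pair? m ∧ f ⊆ᵇ m ∧ g ⊆ᵇ m)
                    (λ f g _ → double? (λ a → f a ∧ g a) ∧ double? (λ a → f a ∧ not (g a))) refl f g m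
    (∧-intro (double?-complete f df) (∧-intro (double?-complete g dg) (∧-intro (pair?-complete m pm)
      (∧-intro (⊆ᵇ-complete f m f⊆m) (⊆ᵇ-complete g m g⊆m)))))

module _ {n : ℕ} where

  line : Subset n → Fin n → Word n → Line
  line T i x a = T (x [ i ]≔ a)

  DoubleAlong : Fin n → Subset n → Set
  DoubleAlong i T = ∀ x → Double (line T i x)

  line-update : ∀ T i x a → line T i (x [ i ]≔ a) ≗ line T i x
  line-update T i x a b = cong T ([]≔-idempotent x i)

  line-centre : ∀ T i x → line T i x (lookup x i) ≡ T x
  line-centre T i x = cong T ([]≔-lookup x i)

  line-∖ : ∀ T i x → line (∖[ i ] T) i x ≗ ∖ˡ (line T i x)
  line-∖ T i x a = cong (_∧ not (T (x [ i ]≔ a))) (some-cong (line-update T i x a))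

  ∖-at : ∀ T i x → (∖[ i ] T) x ≡ ∖ˡ (line T i x) (lookup x i)
  ∖-at T i x = cong (λ y → E i T x ∧ not (T y)) (sym ([]≔-lookup x i))

  line-meets⇒nonempty : ∀ (T : Subset n) i x → some (line T i x) ≡ true → Nonempty T
  line-meets⇒nonempty T i x meets = let (a , x[i≔a]∈T) = some-sound (line T i x) meets in x [ i ]≔ a , x[i≔a]∈T

  ∖-doubleAlong : ∀ {T : Subset n} {i} → DoubleAlong i T → DoubleAlong i (∖[ i ] T)
  ∖-doubleAlong {T} {i} d x = double-resp (λ a → sym (line-∖ T i x a)) (∖ˡ-double (line T i x) (d x))

  ∩-∖≐∅ : ∀ (T : Subset n) i → (T ∩ (∖[ i ] T)) ≐ ∅
  ∩-∖≐∅ T i x with T x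
  ... | true  = ∧-zeroʳ (E i T x)
  ... | false = refl

  ∖-involutive : ∀ {T : Subset n} {i} → DoubleAlong i T → (∖[ i ] (∖[ i ] T)) ≐ T
  ∖-involutive {T} {i} d x = begin
    (∖[ i ] (∖[ i ] T)) x                 ≡⟨ ∖-at (∖[ i ] T) i x ⟩
    ∖ˡ (line (∖[ i ] T) i x) (lookup x i) ≡⟨ ∖ˡ-cong (line-∖ T i x) (lookup x i) ⟩
    ∖ˡ (∖ˡ (line T i x)) (lookup x i)     ≡⟨ ∖ˡ-involutive (line T i x) (d x) (lookup x i) ⟩
    line T i x (lookup x i)               ≡⟨ line-centre T i x ⟩
    T x                                   ∎

  ∖-mono : ∀ {S S' : Subset n} {i} → DoubleAlong i S → DoubleAlong i S' → S ⊆ S' → (∖[ i ] S) ⊆ (∖[ i ] S')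
  ∖-mono {S} {S'} {i} d d' S⊆S' x x∈∖S = trans (∖-at S' i x)
    (∖ˡ-mono (line S i x) (line S' i x) (d x) (d' x) (λ a → S⊆S' (x [ i ]≔ a)) (lookup x i)
      (trans (sym (∖-at S i x)) x∈∖S))

  ∖-mono⇔ : ∀ {S S' : Subset n} {i} → DoubleAlong i S → DoubleAlong i S' → (S ⊆ S') ⇔ ((∖[ i ] S) ⊆ (∖[ i ] S'))
  ∖-mono⇔ {S} {S'} {i} d d' = mk⇔ (∖-mono d d') reflect
    where
    reflect : (∖[ i ] S) ⊆ (∖[ i ] S') → S ⊆ S'
    reflect ∖S⊆∖S' x x∈S = trans (sym (∖-involutive {S'} d' x))
      (∖-mono (∖-doubleAlong {S} d) (∖-doubleAlong {S'} d') ∖S⊆∖S' x (trans (∖-involutive {S} d x) x∈S))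

  ∖-∪ : ∀ {S S' : Subset n} {i} → DoubleAlong i S → DoubleAlong i S' → DoubleAlong i (S ∪ S') →
        (∖[ i ] (S ∪ S')) ≐ ((∖[ i ] S) ∪ (∖[ i ] S'))
  ∖-∪ {S} {S'} {i} d d' d∪ x = begin
    (∖[ i ] (S ∪ S')) x                                        ≡⟨ ∖-at (S ∪ S') i x ⟩
    ∖ˡ (line S i x ∪ˡ line S' i x) (lookup x i)                ≡⟨ ∖ˡ-∪ (line S i x) (line S' i x) (d x) (d' x) (d∪ x) (lookup x i) ⟩
    ∖ˡ (line S i x) (lookup x i) ∨ ∖ˡ (line S' i x) (lookup x i) ≡⟨ sym (cong₂ _∨_ (∖-at S i x) (∖-at S' i x)) ⟩
    ((∖[ i ] S) ∪ (∖[ i ] S')) x                               ∎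

  mds-resp : ∀ {T T' : Subset n} → T ≐ T' → DoubleMDS T → DoubleMDS T'
  mds-resp T≐T' m i x = trans (sym (count-cong (λ a → T≐T' (x [ i ]≔ a)))) (m i x)

  ∁-mds : ∀ {T : Subset n} → DoubleMDS T → DoubleMDS (∁ T)
  ∁-mds {T} m i x = pair-not (line T i x) (m i x)

  mds⇒∖≐∁ : ∀ {T : Subset n} → DoubleMDS T → ∀ i → (∖[ i ] T) ≐ ∁ T
  mds⇒∖≐∁ {T} m i x = begin
    (∖[ i ] T) x                      ≡⟨ ∖-at T i x ⟩
    ∖ˡ (line T i x) (lookup x i)      ≡⟨ ∖ˡ-pair (line T i x) (m i x) (lookup x i) ⟩
    not (line T i x (lookup x i))     ≡⟨ cong not (line-centre T i x) ⟩
    ∁ T x                             ∎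

  ∖-preserves-mds : ∀ {T : Subset n} i → DoubleMDS T → DoubleMDS (∖[ i ] T)
  ∖-preserves-mds {T} i m = mds-resp (λ x → sym (mds⇒∖≐∁ {T} m i x)) (∁-mds {T} m)

  mds⇔∖-mds : ∀ {S : Subset n} {i} → DoubleAlong i S → DoubleMDS S ⇔ DoubleMDS (∖[ i ] S)
  mds⇔∖-mds {S} {i} d = mk⇔ (∖-preserves-mds {S} i)
    (λ m → mds-resp (∖-involutive {S} d) (∖-preserves-mds {∖[ i ] S} i m))

sum-map-cong : ∀ {f g : A → ℕ} → f ≗ g → ∀ xs → sum (map f xs) ≡ sum (map g xs)
sum-map-cong f≗g xs = cong sum (map-cong f≗g xs)

sum-map-+ : ∀ (f g : A → ℕ) xs → sum (map (λ x → f x + g x) xs) ≡ sum (map f xs) + sum (map g xs)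
sum-map-+ f g []       = refl
sum-map-+ f g (x ∷ xs) =
  trans (cong (f x + g x +_) (sum-map-+ f g xs)) (interchange +-commutativeSemigroup (f x) (g x) _ _)

sum-map-* : ∀ c (f : A → ℕ) xs → sum (map (λ x → c * f x) xs) ≡ c * sum (map f xs)
sum-map-* c f []       = sym (*-zeroʳ c)
sum-map-* c f (x ∷ xs) =
  trans (cong (c * f x +_) (sum-map-* c f xs)) (sym (*-distribˡ-+ c (f x) _))

sum-map-0 : ∀ (xs : List A) → sum (map (λ _ → 0) xs) ≡ 0
sum-map-0 []       = refl
sum-map-0 (_ ∷ xs) = sum-map-0 xs

sum-map-swap : ∀ (k : A → B → ℕ) xs ys →
               sum (map (λ x → sum (map (k x) ys)) xs) ≡ sum (map (λ y → sum (map (λ x → k x y) xs)) ys)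
sum-map-swap k []       ys = sym (sum-map-0 ys)
sum-map-swap k (x ∷ xs) ys =
  trans (cong (sum (map (k x) ys) +_) (sum-map-swap k xs ys)) (sym (sum-map-+ (k x) _ ys))

sum-map-concatMap : ∀ (h : B → ℕ) (f : A → List B) xs →
                    sum (map h (concatMap f xs)) ≡ sum (map (λ x → sum (map h (f x))) xs)
sum-map-concatMap h f []       = refl
sum-map-concatMap h f (x ∷ xs) = begin
  sum (map h (f x ++ concatMap f xs))                 ≡⟨ cong sum (map-++ h (f x) _) ⟩
  sum (map h (f x) ++ map h (concatMap f xs))         ≡⟨ sum-++ (map h (f x)) _ ⟩
  sum (map h (f x)) + sum (map h (concatMap f xs))    ≡⟨ cong (_ +_) (sum-map-concatMap h f xs) ⟩
  sum (map h (f x)) + sum (map (λ x → sum (map h (f x))) xs) ∎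

sum-map-mono : ∀ {f g : A → ℕ} → (∀ x → f x ≤ g x) → ∀ xs → sum (map f xs) ≤ sum (map g xs)
sum-map-mono f≤g []       = z≤n
sum-map-mono f≤g (x ∷ xs) = +-mono-≤ (f≤g x) (sum-map-mono f≤g xs)

sum-map-≤-≡ : ∀ {f g : A → ℕ} → (∀ x → f x ≤ g x) → ∀ xs →
              sum (map f xs) ≡ sum (map g xs) → All (λ x → f x ≡ g x) xs
sum-map-≤-≡         f≤g []       _  = []
sum-map-≤-≡ {f = f} {g = g} f≤g (x ∷ xs) eq = ≤-antisym (f≤g x) gx≤fx ∷ sum-map-≤-≡ f≤g xs rest
  where
  gx≤fx : g x ≤ f x
  gx≤fx = +-cancelʳ-≤ (sum (map f xs)) (g x) (f x)
    (≤-trans (+-monoʳ-≤ (g x) (sum-map-mono f≤g xs)) (≤-reflexive (sym eq)))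
  rest : sum (map f xs) ≡ sum (map g xs)
  rest = +-cancelˡ-≡ (f x) _ _ (trans eq (cong (_+ sum (map g xs)) (sym (≤-antisym (f≤g x) gx≤fx))))

indicator-sum-pos : ∀ (p : A → Bool) xs → 0 < sum (map (λ x → if p x then 1 else 0) xs) → ∃ λ x → p x ≡ true
indicator-sum-pos p (x ∷ xs) pos with p x in px
... | true  = x , px
... | false = indicator-sum-pos p xs pos

indicator-sum-pos⁺ : ∀ (p : A → Bool) {x xs} → x ∈ₗ xs → p x ≡ true → 0 < sum (map (λ x → if p x then 1 else 0) xs)
indicator-sum-pos⁺ p (here refl) px rewrite px = s≤s z≤n
indicator-sum-pos⁺ p {xs = y ∷ _} (there x∈xs) px with p y
... | true  = s≤s z≤n
... | false = indicator-sum-pos⁺ p x∈xs px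

allWords-complete : ∀ {n} (x : Word n) → x ∈ₗ allWords n
allWords-complete []      = here refl
allWords-complete {suc n} (a ∷ x) = ∈-concatMap⁺ (λ b → map (b ∷_) (allWords n))
  (Any.map (λ { refl → ∈-map⁺ (a ∷_) (allWords-complete x) }) (∈-allFin a))

∑ : ∀ {n} → (Word n → ℕ) → ℕ
∑ {n} h = sum (map h (allWords n))

∑-∷ : ∀ {n} (h : Word (suc n) → ℕ) → ∑ h ≡ sum (map (λ a → ∑ (h ∘ (a ∷_))) (allFin 4))
∑-∷ {n} h = trans (sum-map-concatMap h (λ a → map (a ∷_) (allWords n)) (allFin 4))
  (sum-map-cong (λ a → cong sum (sym (map-∘ {g = h} {f = a ∷_} (allWords n)))) (allFin 4))

-- Summed over all words, lineCount T i counts each element of T once for each of the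
-- four words on its i-line.
∑-lineCount : ∀ {n} (T : Subset n) i → ∑ (lineCount T i) ≡ 4 * ∣ T ∣
-- For i = zero, lineCount T zero (a ∷ y) does not depend on a, and a sum of four equal
-- terms is 4 * _ by computation.
∑-lineCount {suc n} T zero = begin
  ∑ (lineCount T zero)                                                         ≡⟨ ∑-∷ (lineCount T zero) ⟩
  4 * ∑ (λ y → sum (map (λ b → if T (b ∷ y) then 1 else 0) (allFin 4)))        ≡⟨ cong (4 *_) (sum-map-swap (λ y b → if T (b ∷ y) then 1 else 0) (allWords n) (allFin 4)) ⟩
  4 * sum (map (λ b → ∑ (λ y → if T (b ∷ y) then 1 else 0)) (allFin 4))        ≡⟨ cong (4 *_) (sym (∑-∷ (λ x → if T x then 1 else 0))) ⟩
  4 * ∣ T ∣                                                                    ∎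
∑-lineCount {suc n} T (suc i) = begin
  ∑ (lineCount T (suc i))                                   ≡⟨ ∑-∷ (lineCount T (suc i)) ⟩
  sum (map (λ a → ∑ (lineCount (T ∘ (a ∷_)) i)) (allFin 4)) ≡⟨ sum-map-cong (λ a → ∑-lineCount (T ∘ (a ∷_)) i) (allFin 4) ⟩
  sum (map (λ a → 4 * ∣ T ∘ (a ∷_) ∣) (allFin 4))          ≡⟨ sum-map-* 4 (λ a → ∣ T ∘ (a ∷_) ∣) (allFin 4) ⟩
  4 * sum (map (λ a → ∣ T ∘ (a ∷_) ∣) (allFin 4))          ≡⟨ cong (4 *_) (sym (∑-∷ (λ x → if T x then 1 else 0))) ⟩
  4 * ∣ T ∣                                                 ∎

module _ {n : ℕ} where

  ∣∣-by-lineCount : ∀ {T T' : Subset n} i → (∀ x → lineCount T i x ≡ lineCount T' i x) → ∣ T ∣ ≡ ∣ T' ∣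
  ∣∣-by-lineCount {T} {T'} i eq = *-cancelˡ-≡ ∣ T ∣ ∣ T' ∣ 4
    (trans (sym (∑-lineCount T i)) (trans (sum-map-cong eq (allWords n)) (∑-lineCount T' i)))

  ∣∖∣ : ∀ {S : Subset n} {i} → DoubleAlong i S → ∣ S ∣ ≡ ∣ ∖[ i ] S ∣
  ∣∖∣ {S} {i} d = ∣∣-by-lineCount i (λ x → sym (trans (count-cong (line-∖ S i x)) (count-∖ˡ (line S i x) (d x))))

  pairs⇒mds : ∀ {S : Subset n} {i} → DoubleCode S → (∀ x → Pair (line S i x)) → DoubleMDS S
  pairs⇒mds {S} {i} d p j x =
    All.lookup (sum-map-≤-≡ (λ y → double≤2 (line S j y) (d j y)) (allWords n) sums) (allWords-complete x)
    where
    sums : ∑ (lineCount S j) ≡ ∑ {n} (λ _ → 2)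
    sums = trans (∑-lineCount S j) (trans (sym (∑-lineCount S i)) (sum-map-cong p (allWords n)))

  nonempty⇔∣∣>0 : ∀ (T : Subset n) → Nonempty T ⇔ (∣ T ∣ > 0)
  nonempty⇔∣∣>0 T = mk⇔ (λ (x , x∈T) → indicator-sum-pos⁺ T (allWords-complete x) x∈T)
                        (indicator-sum-pos T (allWords n))

  nonempty-or-empty : ∀ (T : Subset n) → Nonempty T ⊎ (T ≐ ∅)
  nonempty-or-empty T with ∣ T ∣ in size
  ... | suc _ = inj₁ (Equivalence.from (nonempty⇔∣∣>0 T) (subst (0 <_) (sym size) (s≤s z≤n)))
  ... | zero  = inj₂ λ x → ¬-not {y = true} λ x∈T →
    n≮0 (subst (0 <_) size (Equivalence.to (nonempty⇔∣∣>0 T) (x , x∈T)))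

-- g a b is the point with coordinates a and b in the two directions of a plane, so
-- columns are lines of the first direction (∖₁) and rows lines of the second (∖₂).
Grid : Set
Grid = Fin 4 → Line

col : Grid → Fin 4 → Line
col g b a = g a b

∖₁ ∖₂ : Grid → Grid
∖₁ g a b = ∖ˡ (col g b) a
∖₂ g a   = ∖ˡ (g a)

∖₁-cong : ∀ {g h : Grid} → (∀ a b → g a b ≡ h a b) → ∀ a b → ∖₁ g a b ≡ ∖₁ h a b
∖₁-cong g≈h a b = ∖ˡ-cong (λ a' → g≈h a' b) a

∖₂-cong : ∀ {g h : Grid} → (∀ a b → g a b ≡ h a b) → ∀ a b → ∖₂ g a b ≡ ∖₂ h a b
∖₂-cong g≈h a = ∖ˡ-cong (g≈h a)

∀ᵍ : (Fin 4 → Fin 4 → Bool) → Bool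
∀ᵍ p = ∀ᶠ λ a → ∀ᶠ (p a)

∀ᵍ-sound : ∀ p → ∀ᵍ p ≡ true → ∀ a b → p a b ≡ true
∀ᵍ-sound p h a = ∀ᶠ-sound (p a) (∀ᶠ-sound (λ a → ∀ᶠ (p a)) h a)

∀ᵍ-complete : ∀ p → (∀ a b → p a b ≡ true) → ∀ᵍ p ≡ true
∀ᵍ-complete p h = ∀ᶠ-complete (λ a → ∀ᶠ (p a)) (λ a → ∀ᶠ-complete (p a) (h a))

record DoubleInMDS (g m : Grid) : Set where
  field
    rows-pair   : ∀ a → Pair (m a)
    cols-pair   : ∀ b → Pair (col m b)
    rows-double : ∀ a → Double (g a)
    cols-double : ∀ b → Double (col g b)
    ⊆-rows      : ∀ a → g a ⊆ˡ m a

planeLaw₁ planeLaw₂ planeLaw₃ planeLaw₄ planeLaws : Grid → Bool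
planeLaw₁ g = ∀ᶠ λ a → double? (∖₁ g a)
planeLaw₂ g = ∀ᵍ λ a b → ∖₁ (∖₂ g) a b == ∖₂ (∖₁ g) a b
planeLaw₃ g = ∀ᵍ (λ a b → g a b ⇒ ∖₁ (∖₂ g) a b) ⇒ ∀ᵍ (λ a b → ∖₁ g a b == ∖₂ g a b)
planeLaw₄ g = ∀ᵍ (λ a b → g a b ⇒ not (∖₁ (∖₂ g) a b)) ⇒ ∀ᵍ (λ a b → not (∖₁ g a b ∧ ∖₂ g a b))
planeLaws g = planeLaw₁ g ∧ planeLaw₂ g ∧ planeLaw₃ g ∧ planeLaw₄ g

record PlaneLaws (g : Grid) : Set where
  field
    ∖₁-rows-double : ∀ a → Double (∖₁ g a)
    ∖₁∖₂≡∖₂∖₁      : ∀ a b → ∖₁ (∖₂ g) a b ≡ ∖₂ (∖₁ g) a b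
    ∖₁≡∖₂          : (∀ a b → g a b ≡ true → ∖₁ (∖₂ g) a b ≡ true) → ∀ a b → ∖₁ g a b ≡ ∖₂ g a b
    ∖₁∩∖₂≡∅        : (∀ a b → g a b ≡ true → ∖₁ (∖₂ g) a b ≡ false) → ∀ a b → (∖₁ g a b ∧ ∖₂ g a b) ≡ false

planeLaws-sound : ∀ g → planeLaws g ≡ true → PlaneLaws g
planeLaws-sound g ok = record
  { ∖₁-rows-double = λ a → double?-sound (∖₁ g a) (∀ᶠ-sound (λ a → double? (∖₁ g a)) law₁ a)
  ; ∖₁∖₂≡∖₂∖₁      = λ a b → ==-sound (∀ᵍ-sound (λ a b → ∖₁ (∖₂ g) a b == ∖₂ (∖₁ g) a b) law₂ a b)
  ; ∖₁≡∖₂          = λ h a b → ==-sound (∀ᵍ-sound (λ a b → ∖₁ g a b == ∖₂ g a b)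
                       (⇒-elim law₃ (∀ᵍ-complete (λ a b → g a b ⇒ ∖₁ (∖₂ g) a b) (λ a b → ⇒-intro (h a b)))) a b)
  ; ∖₁∩∖₂≡∅        = λ h a b → not-sound (∀ᵍ-sound (λ a b → not (∖₁ g a b ∧ ∖₂ g a b))
                       (⇒-elim law₄ (∀ᵍ-complete (λ a b → g a b ⇒ not (∖₁ (∖₂ g) a b))
                         (λ a b → ⇒-intro (cong not ∘ h a b)))) a b)
  }
  where
  rest₁ = planeLaw₂ g ∧ planeLaw₃ g ∧ planeLaw₄ g
  law₁ : planeLaw₁ g ≡ true
  law₁ = ∧-conicalˡ (planeLaw₁ g) rest₁ ok
  law₂ : planeLaw₂ g ≡ true
  law₂ = ∧-conicalˡ (planeLaw₂ g) _ (∧-conicalʳ (planeLaw₁ g) rest₁ ok)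
  law₃ : planeLaw₃ g ≡ true
  law₃ = ∧-conicalˡ (planeLaw₃ g) (planeLaw₄ g) (∧-conicalʳ (planeLaw₂ g) _ (∧-conicalʳ (planeLaw₁ g) rest₁ ok))
  law₄ : planeLaw₄ g ≡ true
  law₄ = ∧-conicalʳ (planeLaw₃ g) (planeLaw₄ g) (∧-conicalʳ (planeLaw₂ g) _ (∧-conicalʳ (planeLaw₁ g) rest₁ ok))

selectRows : Vec Bool 4 → Grid → Grid
selectRows s m a b = lookup s a ∧ m a b

-- Every double-code inside a grid with two points on each row and column is of the form
-- selectRows s m, since by ⊆pair-shape each of its rows is empty or the row of m.
planeCheckAt : Grid → Bool
planeCheckAt m = ∀ᶠ (pair? ∘ col m) ⇒ ∀ᵛ 4 (λ s → ∀ᶠ (double? ∘ col (selectRows s m)) ⇒ planeLaws (selectRows s m))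

∀ᵖ : (Line → Bool) → Bool
∀ᵖ p = ∀ˡ (λ r → pair? r ⇒ p r)

∀ᵖ-sound : ∀ p → ∀ᵖ p ≡ true → ∀ r → Pair r → p (canon r) ≡ true
∀ᵖ-sound p ok r pr = ∀ˡ⇒-sound pair? p ok r (pair?-complete r pr)

∀ᵖ⁴ : (Line → Line → Line → Line → Bool) → Bool
∀ᵖ⁴ p = ∀ᵖ λ r₀ → ∀ᵖ λ r₁ → ∀ᵖ λ r₂ → ∀ᵖ λ r₃ → p r₀ r₁ r₂ r₃

rows : Line → Line → Line → Line → Grid
rows r₀ r₁ r₂ r₃ = lookup (r₀ ∷ r₁ ∷ r₂ ∷ r₃ ∷ [])

rowsOf : Grid → Grid
rowsOf m = rows (canon (m zero)) (canon (m (suc zero))) (canon (m (suc (suc zero)))) (canon (m (suc (suc (suc zero)))))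

rowsOf-≈ : ∀ (m : Grid) a b → rowsOf m a b ≡ m a b
rowsOf-≈ m zero                   = lookup∘tabulate (m zero)
rowsOf-≈ m (suc zero)             = lookup∘tabulate (m (suc zero))
rowsOf-≈ m (suc (suc zero))       = lookup∘tabulate (m (suc (suc zero)))
rowsOf-≈ m (suc (suc (suc zero))) = lookup∘tabulate (m (suc (suc (suc zero))))

∀ᵖ⁴-sound : ∀ p → ∀ᵖ⁴ p ≡ true → ∀ (m : Grid) → (∀ a → Pair (m a)) →
            p (canon (m zero)) (canon (m (suc zero))) (canon (m (suc (suc zero)))) (canon (m (suc (suc (suc zero))))) ≡ true
∀ᵖ⁴-sound p ok m pm =
  ∀ᵖ-sound (p c₀ c₁ c₂) (∀ᵖ-sound (λ r₂ → ∀ᵖ (p c₀ c₁ r₂)) (∀ᵖ-sound (λ r₁ → ∀ᵖ λ r₂ → ∀ᵖ (p c₀ r₁ r₂))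
    (∀ᵖ-sound (λ r₀ → ∀ᵖ λ r₁ → ∀ᵖ λ r₂ → ∀ᵖ (p r₀ r₁ r₂)) ok (m zero) (pm zero))
      (m (suc zero)) (pm (suc zero))) (m (suc (suc zero))) (pm (suc (suc zero))))
    (m (suc (suc (suc zero)))) (pm (suc (suc (suc zero))))
  where
  c₀ c₁ c₂ : Line
  c₀ = canon (m zero)
  c₁ = canon (m (suc zero))
  c₂ = canon (m (suc (suc zero)))

planeCheck-sound : ∀ (m : Grid) → (∀ a → Pair (m a)) → planeCheckAt (rowsOf m) ≡ true
planeCheck-sound = ∀ᵖ⁴-sound (λ r₀ r₁ r₂ r₃ → planeCheckAt (rows r₀ r₁ r₂ r₃)) refl

PlaneLaws-resp : ∀ {g h : Grid} → (∀ a b → g a b ≡ h a b) → PlaneLaws g → PlaneLaws h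
PlaneLaws-resp {g} {h} g≈h L = record
  { ∖₁-rows-double = λ a → double-resp (∖₁-cong g≈h a) (∖₁-rows-double a)
  ; ∖₁∖₂≡∖₂∖₁      = λ a b → trans (sym (∖₁∖₂≈ a b)) (trans (∖₁∖₂≡∖₂∖₁ a b) (∖₂-cong (∖₁-cong g≈h) a b))
  ; ∖₁≡∖₂          = λ hyp a b → trans (sym (∖₁-cong g≈h a b)) (trans (∖₁≡∖₂ (pull hyp) a b) (∖₂-cong g≈h a b))
  ; ∖₁∩∖₂≡∅        = λ hyp a b → trans (sym (cong₂ _∧_ (∖₁-cong g≈h a b) (∖₂-cong g≈h a b))) (∖₁∩∖₂≡∅ (pull hyp) a b)
  }
  where
  open PlaneLaws L
  ∖₁∖₂≈ : ∀ a b → ∖₁ (∖₂ g) a b ≡ ∖₁ (∖₂ h) a b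
  ∖₁∖₂≈ = ∖₁-cong (∖₂-cong g≈h)
  pull : ∀ {v} → (∀ a b → h a b ≡ true → ∖₁ (∖₂ h) a b ≡ v) → ∀ a b → g a b ≡ true → ∖₁ (∖₂ g) a b ≡ v
  pull hyp a b ga = trans (∖₁∖₂≈ a b) (hyp a b (trans (sym (g≈h a b)) ga))

doubleInMDS⇒planeLaws : ∀ {g m} → DoubleInMDS g m → PlaneLaws g
doubleInMDS⇒planeLaws {g} {m} D =
  PlaneLaws-resp selected≈g (planeLaws-sound (selectRows (tabulate (some ∘ g)) (rowsOf m))
    (⇒-elim (∀ᵛ-sound 4 (λ s → ∀ᶠ (double? ∘ col (selectRows s (rowsOf m))) ⇒ planeLaws (selectRows s (rowsOf m)))
                       (⇒-elim (planeCheck-sound m rows-pair) colsM) (tabulate (some ∘ g)))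
            colsSelected))
  where
  open DoubleInMDS D
  selected≈g : ∀ a b → selectRows (tabulate (some ∘ g)) (rowsOf m) a b ≡ g a b
  selected≈g a b = begin
    lookup (tabulate (some ∘ g)) a ∧ rowsOf m a b ≡⟨ cong₂ _∧_ (lookup∘tabulate (some ∘ g) a) (rowsOf-≈ m a b) ⟩
    some (g a) ∧ m a b                           ≡⟨ ⊆pair-shape (g a) (m a) (rows-double a) (rows-pair a) (⊆-rows a) b ⟨
    g a b                                        ∎
  colsM : ∀ᶠ (pair? ∘ col (rowsOf m)) ≡ true
  colsM = ∀ᶠ-complete (pair? ∘ col (rowsOf m))
    (λ b → pair?-complete (col (rowsOf m) b) (pair-resp (λ a → sym (rowsOf-≈ m a b)) (cols-pair b)))
  colsSelected : ∀ᶠ (double? ∘ col (selectRows (tabulate (some ∘ g)) (rowsOf m))) ≡ true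
  colsSelected = ∀ᶠ-complete (double? ∘ col (selectRows (tabulate (some ∘ g)) (rowsOf m)))
    (λ b → double?-complete (col (selectRows (tabulate (some ∘ g)) (rowsOf m)) b) (double-resp (λ a → sym (selected≈g a b)) (cols-double b)))

module Plane {n : ℕ} {i j : Fin n} (i≢j : i ≢ j) (x : Word n) where

  plane : Subset n → Grid
  plane T a b = T ((x [ i ]≔ a) [ j ]≔ b)

  xᵢ xⱼ : Alphabet
  xᵢ = lookup x i
  xⱼ = lookup x j

  plane-col : ∀ T b → col (plane T) b ≗ line T i (x [ j ]≔ b)
  plane-col T b a = cong T ([]≔-commutes x i j i≢j)

  plane-centre : ∀ T → plane T xᵢ xⱼ ≡ T x
  plane-centre T = cong T (trans (cong (_[ j ]≔ xⱼ) ([]≔-lookup x i)) ([]≔-lookup x j))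

  plane-∖₂ : ∀ T a b → plane (∖[ j ] T) a b ≡ ∖₂ (plane T) a b
  plane-∖₂ T a = line-∖ T j (x [ i ]≔ a)

  plane-∖₁ : ∀ T a b → plane (∖[ i ] T) a b ≡ ∖₁ (plane T) a b
  plane-∖₁ T a b = begin
    (∖[ i ] T) ((x [ i ]≔ a) [ j ]≔ b) ≡⟨ cong (∖[ i ] T) ([]≔-commutes x i j i≢j) ⟩
    line (∖[ i ] T) i (x [ j ]≔ b) a   ≡⟨ line-∖ T i (x [ j ]≔ b) a ⟩
    ∖ˡ (line T i (x [ j ]≔ b)) a       ≡⟨ ∖ˡ-cong (plane-col T b) a ⟨
    ∖₁ (plane T) a b                   ∎

  plane-∖₁∖₂ : ∀ T a b → plane (∖[ i ] (∖[ j ] T)) a b ≡ ∖₁ (∖₂ (plane T)) a b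
  plane-∖₁∖₂ T a b = trans (plane-∖₁ (∖[ j ] T) a b) (∖₁-cong (plane-∖₂ T) a b)

  plane-∖₂∖₁ : ∀ T a b → plane (∖[ j ] (∖[ i ] T)) a b ≡ ∖₂ (∖₁ (plane T)) a b
  plane-∖₂∖₁ T a b = trans (plane-∖₂ (∖[ i ] T) a b) (∖₂-cong (plane-∖₁ T) a b)

  plane-doubleInMDS : ∀ {S M} → DoubleCode S → DoubleMDS M → S ⊆ M → DoubleInMDS (plane S) (plane M)
  plane-doubleInMDS {S} {M} dS mM S⊆M = record
    { rows-pair   = λ a → mM j (x [ i ]≔ a)
    ; cols-pair   = λ b → pair-resp (λ a → sym (plane-col M b a)) (mM i (x [ j ]≔ b))
    ; rows-double = λ a → dS j (x [ i ]≔ a)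
    ; cols-double = λ b → double-resp (λ a → sym (plane-col S b a)) (dS i (x [ j ]≔ b))
    ; ⊆-rows      = λ a b → S⊆M _
    }

  module _ {S M : Subset n} (dS : DoubleCode S) (mM : DoubleMDS M) (S⊆M : S ⊆ M) where

    open PlaneLaws (doubleInMDS⇒planeLaws (plane-doubleInMDS dS mM S⊆M))

    ∖-line-double : Double (line (∖[ i ] S) j x)
    ∖-line-double = double-resp row≗line (∖₁-rows-double xᵢ)
      where
      row≗line : ∖₁ (plane S) xᵢ ≗ line (∖[ i ] S) j x
      row≗line b = trans (sym (plane-∖₁ S xᵢ b)) (cong (λ y → (∖[ i ] S) (y [ j ]≔ b)) ([]≔-lookup x i))

    ∖∖-comm-at : (∖[ i ] (∖[ j ] S)) x ≡ (∖[ j ] (∖[ i ] S)) x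
    ∖∖-comm-at = begin
      (∖[ i ] (∖[ j ] S)) x                   ≡⟨ plane-centre (∖[ i ] (∖[ j ] S)) ⟨
      plane (∖[ i ] (∖[ j ] S)) xᵢ xⱼ         ≡⟨ plane-∖₁∖₂ S xᵢ xⱼ ⟩
      ∖₁ (∖₂ (plane S)) xᵢ xⱼ                 ≡⟨ ∖₁∖₂≡∖₂∖₁ xᵢ xⱼ ⟩
      ∖₂ (∖₁ (plane S)) xᵢ xⱼ                 ≡⟨ plane-∖₂∖₁ S xᵢ xⱼ ⟨
      plane (∖[ j ] (∖[ i ] S)) xᵢ xⱼ         ≡⟨ plane-centre (∖[ j ] (∖[ i ] S)) ⟩
      (∖[ j ] (∖[ i ] S)) x                   ∎

    in-plane : ∀ {v} → (∀ y → S y ≡ true → (∖[ i ] (∖[ j ] S)) y ≡ v) →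
               ∀ a b → plane S a b ≡ true → ∖₁ (∖₂ (plane S)) a b ≡ v
    in-plane hyp a b Sab = trans (sym (plane-∖₁∖₂ S a b)) (hyp _ Sab)

    ∖≡∖-at : S ⊆ (∖[ i ] (∖[ j ] S)) → (∖[ i ] S) x ≡ (∖[ j ] S) x
    ∖≡∖-at S⊆R = begin
      (∖[ i ] S) x                     ≡⟨ plane-centre (∖[ i ] S) ⟨
      plane (∖[ i ] S) xᵢ xⱼ           ≡⟨ plane-∖₁ S xᵢ xⱼ ⟩
      ∖₁ (plane S) xᵢ xⱼ               ≡⟨ ∖₁≡∖₂ (in-plane S⊆R) xᵢ xⱼ ⟩
      ∖₂ (plane S) xᵢ xⱼ               ≡⟨ plane-∖₂ S xᵢ xⱼ ⟨
      plane (∖[ j ] S) xᵢ xⱼ           ≡⟨ plane-centre (∖[ j ] S) ⟩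
      (∖[ j ] S) x                     ∎

    ∖∩∖-at : (S ∩ (∖[ i ] (∖[ j ] S))) ≐ ∅ → ((∖[ i ] S) ∩ (∖[ j ] S)) x ≡ false
    ∖∩∖-at S∩R≐∅ = begin
      (∖[ i ] S) x ∧ (∖[ j ] S) x                 ≡⟨ cong₂ _∧_ (plane-centre (∖[ i ] S)) (plane-centre (∖[ j ] S)) ⟨
      plane (∖[ i ] S) xᵢ xⱼ ∧ plane (∖[ j ] S) xᵢ xⱼ ≡⟨ cong₂ _∧_ (plane-∖₁ S xᵢ xⱼ) (plane-∖₂ S xᵢ xⱼ) ⟩
      ∖₁ (plane S) xᵢ xⱼ ∧ ∖₂ (plane S) xᵢ xⱼ     ≡⟨ ∖₁∩∖₂≡∅ (in-plane (λ y Sy → ∧-true-false Sy (S∩R≐∅ y))) xᵢ xⱼ ⟩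
      false                                      ∎

update-closed : ∀ {n} (U : Word n → Set) → (∀ y k b → U y → U (y [ k ]≔ b)) → ∀ {x} → U x → ∀ y → U y
update-closed {zero}  U step {[]}    u []      = u
update-closed {suc n} U step {a ∷ x} u (b ∷ y) =
  update-closed (U ∘ (b ∷_)) (λ z k c → step (b ∷ z) (suc k) c) (step (a ∷ x) zero b u) y

allPairs-map-with : ∀ {P : A → Set} {R : A → A → Set} {R' : B → B → Set} {f : A → B} {xs} →
                    (∀ {x y} → P x → P y → R x y → R' (f x) (f y)) →
                    All P xs → AllPairs R xs → AllPairs R' (map f xs)
allPairs-map-with h []         []         = []
allPairs-map-with h (px ∷ pxs) (rx ∷ rxs) =
  All-map⁺ (All.zipWith (λ (py , r) → h px py r) (pxs , rx)) ∷ allPairs-map-with h pxs rxs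

module _ {n : ℕ} where

  ∖-⊆∁ : ∀ {S M : Subset n} {i} → DoubleAlong i S → DoubleMDS M → S ⊆ M → (∖[ i ] S) ⊆ ∁ M
  ∖-⊆∁ {S} {M} {i} d mM S⊆M x x∈∖S = trans (cong not (sym (line-centre M i x)))
    (∖ˡ-⊆-not (line S i x) (line M i x) (d x) (mM i x) (λ a → S⊆M (x [ i ]≔ a)) (lookup x i)
      (trans (sym (∖-at S i x)) x∈∖S))

  ∖-complementable : ∀ {S : Subset n} → DoubleCode S → Complementable S → ∀ i → Complementable (∖[ i ] S)
  ∖-complementable dS (M , mM , S⊆M) i = ∁ M , ∁-mds {T = M} mM , ∖-⊆∁ (dS i) mM S⊆M

  ∖-doubleCode : ∀ {S : Subset n} → DoubleCode S → Complementable S → ∀ i → DoubleCode (∖[ i ] S)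
  ∖-doubleCode {S} dS (M , mM , S⊆M) i j x with i ≟ j
  ... | yes refl = ∖-doubleAlong {T = S} (dS i) x
  ... | no i≢j   = Plane.∖-line-double i≢j x dS mM S⊆M

  ∖-comm : ∀ {S : Subset n} → DoubleCode S → Complementable S → ∀ i j →
           (∖[ i ] (∖[ j ] S)) ≐ (∖[ j ] (∖[ i ] S))
  ∖-comm dS (M , mM , S⊆M) i j x with i ≟ j
  ... | yes refl = refl
  ... | no i≢j   = Plane.∖∖-comm-at i≢j x dS mM S⊆M

  complementable-resp : ∀ {S S' : Subset n} → S ≐ S' → Complementable S → Complementable S'
  complementable-resp S≐S' (M , mM , S⊆M) = M , mM , λ x x∈S' → S⊆M x (trans (S≐S' x) x∈S')

  complementable⇔ : ∀ {S : Subset n} → DoubleCode S → ∀ i →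
                    Complementable S ⇔ (Complementable (∖[ i ] S) × DoubleCode (∖[ i ] S))
  complementable⇔ {S} dS i = mk⇔ (λ c → ∖-complementable dS c i , ∖-doubleCode dS c i)
    (λ (c' , d') → complementable-resp (∖-involutive {T = S} (dS i)) (∖-complementable d' c' i))

  ∖-nonempty : ∀ {T : Subset n} {i} → DoubleAlong i T → Nonempty T → Nonempty (∖[ i ] T)
  ∖-nonempty {T} {i} d (y , y∈T) = line-meets⇒nonempty (∖[ i ] T) i y
    (trans (some-cong (line-∖ T i y)) (∖ˡ-some (line T i y) (d y) T-meets))
    where
    T-meets : some (line T i y) ≡ true
    T-meets = some-complete (line T i y) (lookup y i) (trans (line-centre T i y) y∈T)

  ∖-disjoint : ∀ {P Q T : Subset n} {i} → DoubleAlong i P → DoubleAlong i Q → DoubleAlong i T →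
               P ⊆ T → Q ⊆ T → (P ∩ Q) ≐ ∅ → ((∖[ i ] P) ∩ (∖[ i ] Q)) ≐ ∅
  ∖-disjoint {P} {Q} {T} {i} dP dQ dT P⊆T Q⊆T P∩Q≐∅ x =
    trans (cong₂ _∧_ (∖-at P i x) (∖-at Q i x))
      (∖ˡ-disjoint (line P i x) (line Q i x) (line T i x) (dP x) (dQ x) (dT x)
        (λ a → P⊆T _) (λ a → Q⊆T _) (λ a → P∩Q≐∅ _) (lookup x i))

  ⊆-false : ∀ {P T : Subset n} → P ⊆ T → ∀ x → T x ≡ false → P x ≡ false
  ⊆-false {P} P⊆T x Tx≡false with P x in Px
  ... | false = refl
  ... | true  = contradiction (trans (sym (P⊆T x Px)) Tx≡false) λ ()

  ∖-splitting : ∀ {T : Subset n} i → DoubleCode T → Complementable T → Splitting T → Splitting (∖[ i ] T)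
  ∖-splitting {T} i dT (M , mM , T⊆M) (ps , 2≤len , nonempty , doubles , disjoint , cover) =
    map (∖[ i ]_) ps ,
    subst (2 ≤_) (sym (length-map (∖[ i ]_) ps)) 2≤len ,
    All-map⁺ (All.zipWith (λ (neP , dP) → ∖-nonempty (dP i) neP) (nonempty , doubles)) ,
    All-map⁺ (All.zipWith (λ (dP , P⊆T) → ∖-doubleCode dP (M , mM , λ x → T⊆M x ∘ P⊆T x) i) (doubles , parts⊆T)) ,
    allPairs-map-with (λ (dP , P⊆T) (dQ , Q⊆T) → ∖-disjoint (dP i) (dQ i) (dT i) P⊆T Q⊆T)
      (All.zip (doubles , parts⊆T)) disjoint ,
    λ x → mk⇔ (cover⁺ x) (cover⁻ x)
    where
    parts⊆T : All (_⊆ T) ps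
    parts⊆T = All.tabulate (λ P∈ps x x∈P → Equivalence.from (cover x) (lose P∈ps x∈P))
    cover⁺ : ∀ x → x ∈ (∖[ i ] T) → Any (x ∈_) (map (∖[ i ]_) ps)
    cover⁺ x x∈∖T with some-sound (line T i x) (∧-conicalˡ (E i T x) _ x∈∖T)
    ... | a , y∈T with find (Equivalence.to (cover (x [ i ]≔ a)) y∈T)
    ...   | P , P∈ps , y∈P = Any-map⁺ (lose P∈ps (∧-intro (some-complete (line P i x) a y∈P) (cong not Px≡false)))
      where
      Px≡false : P x ≡ false
      Px≡false = ⊆-false (All.lookup parts⊆T P∈ps) x (not-sound (∧-conicalʳ (E i T x) _ x∈∖T))
    cover⁻ : ∀ x → Any (x ∈_) (map (∖[ i ]_) ps) → x ∈ (∖[ i ] T)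
    cover⁻ x x∈∖ps with find (Any-map⁻ x∈∖ps)
    ... | P , P∈ps , x∈∖P = ∖-mono (All.lookup doubles P∈ps i) (dT i) (All.lookup parts⊆T P∈ps) x x∈∖P

  splitting-resp : ∀ {S S' : Subset n} → S ≐ S' → Splitting S → Splitting S'
  splitting-resp S≐S' (ps , 2≤len , nonempty , doubles , disjoint , cover) =
    ps , 2≤len , nonempty , doubles , disjoint ,
    λ x → mk⇔ (Equivalence.to (cover x) ∘ trans (S≐S' x)) (trans (sym (S≐S' x)) ∘ Equivalence.from (cover x))

  prime-resp : ∀ {S S' : Subset n} → S ≐ S' → Prime S → Prime S'
  prime-resp S≐S' (c , (x , x∈S) , unsplittable) =
    complementable-resp S≐S' c , (x , trans (sym (S≐S' x)) x∈S) ,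
    unsplittable ∘ splitting-resp (λ x → sym (S≐S' x))

  ∖-prime : ∀ {S : Subset n} → DoubleCode S → Prime S → ∀ i → Prime (∖[ i ] S)
  ∖-prime {S} dS (c , ne , unsplittable) i =
    ∖-complementable dS c i , ∖-nonempty {S} (dS i) ne ,
    λ sp → unsplittable (splitting-resp (∖-involutive {T = S} (dS i))
                           (∖-splitting i (∖-doubleCode dS c i) (∖-complementable dS c i) sp))

  prime⇔ : ∀ {S : Subset n} → DoubleCode S → ∀ i → Prime S ⇔ (Prime (∖[ i ] S) × DoubleCode (∖[ i ] S))
  prime⇔ {S} dS i = mk⇔ (λ p → ∖-prime dS p i , ∖-doubleCode dS (proj₁ p) i)
    (λ (p' , d') → prime-resp (∖-involutive {T = S} (dS i)) (∖-prime d' p' i))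

  splitting-by : ∀ {S : Subset n} R → DoubleCode (S ∩ R) → DoubleCode (S ∩ ∁ R) →
                 Nonempty (S ∩ R) → Nonempty (S ∩ ∁ R) → Splitting S
  splitting-by {S} R d₁ d₂ ne₁ ne₂ =
    (S ∩ R ∷ S ∩ ∁ R ∷ []) , s≤s (s≤s z≤n) , (ne₁ ∷ ne₂ ∷ []) , (d₁ ∷ d₂ ∷ []) ,
    ((disjoint ∷ []) ∷ [] ∷ []) , λ x → mk⇔ (split x) (merge x)
    where
    disjoint : ((S ∩ R) ∩ (S ∩ ∁ R)) ≐ ∅
    disjoint x with S x | R x
    ... | false | _     = refl
    ... | true  | true  = refl
    ... | true  | false = refl
    split : ∀ x → x ∈ S → Any (x ∈_) (S ∩ R ∷ S ∩ ∁ R ∷ [])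
    split x x∈S with R x in Rx
    ... | true  = here (∧-intro x∈S Rx)
    ... | false = there (here (∧-intro x∈S (cong not Rx)))
    merge : ∀ x → Any (x ∈_) (S ∩ R ∷ S ∩ ∁ R ∷ []) → x ∈ S
    merge x (here x∈S∩R)          = ∧-conicalˡ (S x) _ x∈S∩R
    merge x (there (here x∈S∖R)) = ∧-conicalˡ (S x) _ x∈S∖R

  prime-∖-dichotomy : ∀ {S : Subset n} → DoubleCode S → Prime S → ∀ i j →
                      ((∖[ i ] S) ≐ (∖[ j ] S)) ⊎ (((∖[ i ] S) ∩ (∖[ j ] S)) ≐ ∅)
  prime-∖-dichotomy {S} dS (c@(M , mM , S⊆M) , _ , unsplittable) i j with i ≟ j
  ... | yes refl = inj₁ λ _ → refl
  ... | no i≢j   = dichotomy (nonempty-or-empty (S ∩ R)) (nonempty-or-empty (S ∩ ∁ R))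
    where
    R : Subset n
    R = ∖[ i ] (∖[ j ] S)
    R-double : DoubleCode R
    R-double = ∖-doubleCode (∖-doubleCode dS c j) (∖-complementable dS c j) i
    R⊆M : R ⊆ M
    R⊆M x x∈R = trans (sym (not-involutive (M x)))
      (∖-⊆∁ (∖-doubleCode dS c j i) (∁-mds {T = M} mM) (∖-⊆∁ (dS j) mM S⊆M) x x∈R)
    parts-double : ∀ k y → Double (line (S ∩ R) k y) × Double (line (S ∩ ∁ R) k y)
    parts-double k y = ∩-double (line S k y) (line R k y) (line M k y) (dS k y) (R-double k y) (mM k y)
                                (λ a → S⊆M (y [ k ]≔ a)) (λ a → R⊆M (y [ k ]≔ a))
    dichotomy : Nonempty (S ∩ R) ⊎ ((S ∩ R) ≐ ∅) → Nonempty (S ∩ ∁ R) ⊎ ((S ∩ ∁ R) ≐ ∅) →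
                ((∖[ i ] S) ≐ (∖[ j ] S)) ⊎ (((∖[ i ] S) ∩ (∖[ j ] S)) ≐ ∅)
    dichotomy (inj₁ ne₁) (inj₁ ne₂) = contradiction
      (splitting-by R (λ k y → proj₁ (parts-double k y)) (λ k y → proj₂ (parts-double k y)) ne₁ ne₂) unsplittable
    dichotomy _ (inj₂ S∖R≐∅) = inj₁ λ x → Plane.∖≡∖-at i≢j x dS mM S⊆M
      (λ y y∈S → not-injective (∧-true-false y∈S (S∖R≐∅ y)))
    dichotomy (inj₂ S∩R≐∅) _ = inj₂ λ x → Plane.∖∩∖-at i≢j x dS mM S⊆M S∩R≐∅

  ∪-∖≐E : ∀ (S : Subset n) k → (S ∪ (∖[ k ] S)) ≐ E k S
  ∪-∖≐E S k x = ∨-∧-not (S x) (E k S x) (some-complete (line S k x) (lookup x k) ∘ trans (line-centre S k x))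

  ∖-constant⇒mds : ∀ {S : Subset n} → DoubleCode S → ∣ S ∣ > 0 → (∀ k k' → (∖[ k ] S) ≐ (∖[ k' ] S)) → DoubleMDS S
  ∖-constant⇒mds {S} dS pos same j x = double-some⇒pair (line S j x) (dS j x) (E-total x)
    where
    E-indep : ∀ k k' y → E k S y ≡ E k' S y
    E-indep k k' y = trans (sym (∪-∖≐E S k y)) (trans (cong (S y ∨_) (same k k' y)) (∪-∖≐E S k' y))
    step : ∀ y k b → E j S y ≡ true → E j S (y [ k ]≔ b) ≡ true
    step y k b h = trans (E-indep j k _) (trans (some-cong (line-update S k y b)) (trans (E-indep k j y) h))
    E-total : ∀ y → E j S y ≡ true
    E-total with Equivalence.from (nonempty⇔∣∣>0 S) pos
    ... | y₀ , y₀∈S = update-closed (λ y → E j S y ≡ true) step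
                        (some-complete (line S j y₀) (lookup y₀ j) (trans (line-centre S j y₀) y₀∈S))

  mds⇒nonempty : ∀ {S : Subset n} → DoubleMDS S → Fin n → Nonempty S
  mds⇒nonempty {S} mS i = line-meets⇒nonempty S i w (pair-some (line S i w) (mS i w))
    where
    w : Word n
    w = replicate n zero

  mds⇔∖-constant : ∀ {S : Subset n} → DoubleCode S → Fin n →
                   DoubleMDS S ⇔ ((∣ S ∣ > 0) × (∀ k k' → (∖[ k ] S) ≐ (∖[ k' ] S)))
  mds⇔∖-constant {S} dS i = mk⇔
    (λ mS → Equivalence.to (nonempty⇔∣∣>0 S) (mds⇒nonempty mS i) ,
            λ k k' x → trans (mds⇒∖≐∁ {T = S} mS k x) (sym (mds⇒∖≐∁ {T = S} mS k' x)))
    (λ (pos , same) → ∖-constant⇒mds dS pos same)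

  ∖≐∁⇒E : ∀ {S : Subset n} {i} → (∖[ i ] S) ≐ ∁ S → ∀ x → E i S x ≡ true
  ∖≐∁⇒E {S} {i} ∖S≐∁S x = trans (sym (∪-∖≐E S i x)) (trans (cong (S x ∨_) (∖S≐∁S x)) (∨-inverseʳ (S x)))

  mds⇔∖≐∁ : ∀ {S : Subset n} → DoubleCode S → ∀ i → DoubleMDS S ⇔ ((∖[ i ] S) ≐ ∁ S)
  mds⇔∖≐∁ {S} dS i = mk⇔ (λ mS → mds⇒∖≐∁ {T = S} mS i)
    (λ ∖S≐∁S → pairs⇒mds {S = S} {i = i} dS (λ x → double-some⇒pair (line S i x) (dS i x) (∖≐∁⇒E ∖S≐∁S x)))

proposition6 : (n : ℕ) (S S' : Subset n) (i i' : Fin n) →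
    DoubleCode S → DoubleCode S' →
      ((S ∩ (∖[ i ] S)) ≐ ∅)
    × ((∖[ i ] (∖[ i ] S)) ≐ S)
    × (∣ S ∣ ≡ ∣ ∖[ i ] S ∣)
    × ((S ⊆ S') ⇔ ((∖[ i ] S) ⊆ (∖[ i ] S')))
    × (DoubleCode (S ∪ S') → (∖[ i ] (S ∪ S')) ≐ ((∖[ i ] S) ∪ (∖[ i ] S')))
    × ((DoubleMDS S ⇔ DoubleMDS (∖[ i ] S)) × (DoubleMDS S ⇔ ((∖[ i ] S) ≐ ∁ S)))
    × (Complementable S ⇔ (Complementable (∖[ i ] S) × DoubleCode (∖[ i ] S)))
    × (Prime S ⇔ (Prime (∖[ i ] S) × DoubleCode (∖[ i ] S)))
    × (Prime S → ((∖[ i ] S) ≐ (∖[ i' ] S)) ⊎ (((∖[ i ] S) ∩ (∖[ i' ] S)) ≐ ∅))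
    × (Complementable S → (∖[ i ] (∖[ i' ] S)) ≐ (∖[ i' ] (∖[ i ] S)))
    × (DoubleMDS S ⇔ ((∣ S ∣ > 0) × (∀ (j j' : Fin n) → (∖[ j ] S) ≐ (∖[ j' ] S))))
proposition6 n S S' i i' dS dS' =
    ∩-∖≐∅ S i
  , ∖-involutive {T = S} (dS i)
  , ∣∖∣ {S = S} (dS i)
  , ∖-mono⇔ (dS i) (dS' i)
  , (λ dS∪S' → ∖-∪ {S = S} {S' = S'} (dS i) (dS' i) (dS∪S' i))
  , (mds⇔∖-mds {S = S} (dS i) , mds⇔∖≐∁ dS i)
  , complementable⇔ dS i
  , prime⇔ dS i
  , (λ p → prime-∖-dichotomy dS p i i')
  , (λ c → ∖-comm dS c i i')
  , mds⇔∖-constant dS i
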